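{- Fix $\nu\in\{1,2,3,4\}$ and $k\in\mathrm I$, and suppose that the linear forms $\Lambda_{i_\nu}$ and $\Lambda_k$ are linearly independent. Then $\mathrm I$ has two disjoint subsets $\mathrm I_0$ and $\mathrm I_1$, each with exactly eight elements, such that: (i) $k\in\mathrm I_0$, and for every $j\in\mathrm I_0$ the forms $\Lambda_j$ and $\Lambda_{i_\nu}$ are linearly independent; (ii) at most four indices in $\mathrm I_1$ are mutually equivalent (i.e. every equivalence class meets $\mathrm I_1$ in at most four elements).
   Context: Let $s\ge22$ and let $A_j,B_j$ ($1\le j\le s$) be integers with $(A_j,B_j)\ne(0,0)$ such that $q_0(\mathbf A,\mathbf B)=\min_{(C,D)\in\mathbb Z^2\setminus\{(0,0)\}}\#\{j:CA_j+DB_j\ne0\}\ge12$, and such that the system $\sum_jA_jx_j^4=\sum_jB_jx_j^4=0$ has non-singular solutions in $\mathbb R$ and in every $\mathbb Q_p$. Let $\Lambda_j=A_j\alpha+B_j\beta$. Indices $i,j\in\{1,\dots,s\}$ are equivalent if $\Lambda_i=\lambda\Lambda_j$ for some non-zero rational $\lambda$. Let the equivalence classes have sizes $r_1\ge r_2\ge\dots\ge r_t$, and assume $r_1\le7$ and $r_2\le5$ (so that $t\ge4$). For $1\le\nu\le4$ let $i_\nu$ be an index in the $\nu$-th class (of size $r_\nu$), and put $\mathrm I=\{1,\dots,s\}\setminus\{i_1,i_2,i_3,i_4\}$. -}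

module Defs where

open import Data.Nat using (ℕ; _≤_)
open import Data.Fin using (Fin)
open import Data.Fin.Subset using (Subset; _∈_)
open import Data.Integer as ℤ using (ℤ)
open import Data.Rational as ℚ using (ℚ; 0ℚ; _/_)
open import Data.List using (length; filter; allFin)
open import Data.Product using (Σ; _×_)
open import Function.Bundles using (_⇔_)
open import Relation.Binary.PropositionalEquality using (_≡_; _≢_)
open import Relation.Nullary using (¬_; ¬?)

toℚ : ℤ → ℚ
toℚ z = z / 1

module _ {s : ℕ} (A B : Fin s → ℤ) where

  -- Λ_i = λ Λ_j for some non-zero rational λ  (Λ_j = A_j α + B_j β)
  Equiv : Fin s → Fin s → Set
  Equiv i j = Σ ℚ λ l → (l ≢ 0ℚ) × ((toℚ (A i) ≡ l ℚ.* toℚ (A j)) × (toℚ (B i) ≡ l ℚ.* toℚ (B j)))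

  LinIndep : Fin s → Fin s → Set
  LinIndep i j = (c d : ℚ) →
    c ℚ.* toℚ (A i) ℚ.+ d ℚ.* toℚ (A j) ≡ 0ℚ →
    c ℚ.* toℚ (B i) ℚ.+ d ℚ.* toℚ (B j) ≡ 0ℚ →
    (c ≡ 0ℚ) × (d ≡ 0ℚ)

  IsClassOf : Subset s → Fin s → Set
  IsClassOf S i = (j : Fin s) → (j ∈ S) ⇔ Equiv j i

  support : ℤ → ℤ → ℕ
  support C D = length (filter (λ j → ¬? ((C ℤ.* A j ℤ.+ D ℤ.* B j) ℤ.≟ ℤ.0ℤ)) (allFin s))

  q0≥ : ℕ → Set
  q0≥ q = (C D : ℤ) → ¬ ((C ≡ ℤ.0ℤ) × (D ≡ ℤ.0ℤ)) → q ≤ support C D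

-- Write K₀, …, K₃ for the classes of i₁, …, i₄; I has at least 22 − 4 = 18 elements.
-- I₀ is drawn from the at least 18 − 7 = 11 indices of I outside the class of i_ν; for
-- these j, Λ_j is not proportional to Λ_{i_ν}, hence independent of it. I₁ is drawn
-- from the at least 10 indices of I outside I₀: at most four from K₀, the rest from a pool
-- meeting every other class in at most four indices. If |K₃| ≤ 4, all classes outside
-- K₀, …, K₃ have at most four elements and K₁, K₂, K₃ lose their representative in I, so
-- the pool is I; otherwise every K_μ has at least five elements and the pool is the union
-- of the K_μ ∩ I, which has at least 16 elements, 12 of them outside K₀.
module Submission where

open import Defs
open import Data.Fin using (Fin; _<_; zero; suc)
open import Data.Fin.Subset using (Subset; _∈_; _∉_; ∣_∣; _∩_)
open import Data.Integer using (ℤ; 0ℤ)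
open import Data.Nat using (ℕ; _≤_)
open import Data.Product using (Σ; _×_)
open import Relation.Binary.PropositionalEquality using (_≡_; _≢_)
open import Relation.Nullary using (¬_)

open import Data.Bool using (true; false)
import Data.Fin as Fin
import Data.Fin.Properties as Finₚ
open import Data.Fin.Subset
open import Data.Fin.Subset.Properties
open import Data.Integer.GCD using (gcd)
import Data.Integer as ℤ
open import Data.List using (tabulate)
open import Data.Nat using (zero; suc; _+_; _*_; _∸_; _⊓_; _≤?_; z≤n; s≤s)
import Data.Nat.Properties as ℕₚ
open import Data.Product using (∃; _,_; proj₂)
open import Data.Rational as ℚ using (ℚ; 0ℚ; 1ℚ; 1/_; NonZero; ≢-nonZero)
import Data.Rational.Properties as ℚₚ
open import Data.Rational.Solver using (module +-*-Solver)
open import Data.Sum using (inj₁; inj₂)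
open import Data.Vec using ([]; _∷_; here; there)
open import Function.Base using (_∘_; _∘′_; id; case_of_)
open import Function.Bundles using (Equivalence)
open import Relation.Binary.PropositionalEquality
open import Relation.Nullary using (yes; no; contradiction)

open +-*-Solver

toℚ≡0⇒≡0 : ∀ z → toℚ z ≡ 0ℚ → z ≡ 0ℤ
toℚ≡0⇒≡0 z eq = trans (sym (ℚₚ.↥-/ z 1)) (cong (λ q → ℚ.↥ q ℤ.* gcd z (ℤ.+ 1)) eq)

1/p*[p*q]≡q : ∀ p .{{_ : NonZero p}} q → 1/ p ℚ.* (p ℚ.* q) ≡ q
1/p*[p*q]≡q p q = begin
  1/ p ℚ.* (p ℚ.* q)  ≡⟨ ℚₚ.*-assoc (1/ p) p q ⟨
  1/ p ℚ.* p ℚ.* q    ≡⟨ cong (ℚ._* q) (ℚₚ.*-inverseˡ p) ⟩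
  1ℚ ℚ.* q            ≡⟨ ℚₚ.*-identityˡ q ⟩
  q                   ∎
  where open ≡-Reasoning

p*q≡0⇒q≡0 : ∀ p .{{_ : NonZero p}} q → p ℚ.* q ≡ 0ℚ → q ≡ 0ℚ
p*q≡0⇒q≡0 p q eq = begin
  q                   ≡⟨ 1/p*[p*q]≡q p q ⟨
  1/ p ℚ.* (p ℚ.* q)  ≡⟨ cong (1/ p ℚ.*_) eq ⟩
  1/ p ℚ.* 0ℚ         ≡⟨ ℚₚ.*-zeroʳ (1/ p) ⟩
  0ℚ                  ∎
  where open ≡-Reasoning

1/p≢0 : ∀ p .{{_ : NonZero p}} → 1/ p ≢ 0ℚ
1/p≢0 p eq = ℚₚ.1≢0 (trans (sym (ℚₚ.*-inverseˡ p)) (trans (cong (ℚ._* p) eq) (ℚₚ.*-zeroˡ p)))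

p≢0∧q≢0⇒p*q≢0 : ∀ {p q} → p ≢ 0ℚ → q ≢ 0ℚ → p ℚ.* q ≢ 0ℚ
p≢0∧q≢0⇒p*q≢0 {p} {q} p≢0 q≢0 = q≢0 ∘′ p*q≡0⇒q≡0 p {{≢-nonZero p≢0}} q

p*x+q*y≡0⇒x≡-q/p*y : ∀ p .{{_ : NonZero p}} q x y →
                     p ℚ.* x ℚ.+ q ℚ.* y ≡ 0ℚ → x ≡ ℚ.- (1/ p) ℚ.* q ℚ.* y
p*x+q*y≡0⇒x≡-q/p*y p q x y eq = begin
  x                                                 ≡⟨ 1/p*[p*q]≡q p x ⟨
  r ℚ.* (p ℚ.* x)                                   ≡⟨ solve 5 (λ r p x q y → r :* (p :* x) := r :* (p :* x :+ q :* y) :+ (:- r) :* q :* y) refl r p x q y ⟩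
  r ℚ.* (p ℚ.* x ℚ.+ q ℚ.* y) ℚ.+ ℚ.- r ℚ.* q ℚ.* y ≡⟨ cong (λ t → r ℚ.* t ℚ.+ ℚ.- r ℚ.* q ℚ.* y) eq ⟩
  r ℚ.* 0ℚ ℚ.+ ℚ.- r ℚ.* q ℚ.* y                    ≡⟨ solve 3 (λ r q y → r :* con 0ℚ :+ (:- r) :* q :* y := (:- r) :* q :* y) refl r q y ⟩
  ℚ.- r ℚ.* q ℚ.* y                                 ∎
  where
  open ≡-Reasoning
  r = 1/ p

module _ {s : ℕ} (A B : Fin s → ℤ) where

  Equiv-refl : ∀ i → Equiv A B i i
  Equiv-refl i = 1ℚ , ℚₚ.1≢0 , sym (ℚₚ.*-identityˡ _) , sym (ℚₚ.*-identityˡ _)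

  Equiv-sym : ∀ {i j} → Equiv A B i j → Equiv A B j i
  Equiv-sym (l , l≢0 , eqA , eqB) =
    1/ l , 1/p≢0 l , flip eqA , flip eqB
    where
    instance _ = ≢-nonZero l≢0
    flip : ∀ {x y} → x ≡ l ℚ.* y → y ≡ 1/ l ℚ.* x
    flip {x} {y} x≡ly = trans (sym (1/p*[p*q]≡q l y)) (cong (1/ l ℚ.*_) (sym x≡ly))

  Equiv-trans : ∀ {i j k} → Equiv A B i j → Equiv A B j k → Equiv A B i k
  Equiv-trans (l , l≢0 , eqA , eqB) (m , m≢0 , eqA′ , eqB′) =
    l ℚ.* m , p≢0∧q≢0⇒p*q≢0 l≢0 m≢0 ,
    trans eqA (trans (cong (l ℚ.*_) eqA′) (sym (ℚₚ.*-assoc l m _))) ,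
    trans eqB (trans (cong (l ℚ.*_) eqB′) (sym (ℚₚ.*-assoc l m _)))

  -- If Λ_k = l Λ_i then l Λ_i + (-1) Λ_k = 0 is a non-trivial relation.
  LinIndep⇒¬Equiv : ∀ {i k} → LinIndep A B i k → ¬ Equiv A B k i
  LinIndep⇒¬Equiv ind (l , _ , eqA , eqB) =
    ℚₚ.1≢0 (ℚₚ.neg-injective (proj₂ (ind l (ℚ.- 1ℚ) (relation eqA) (relation eqB))))
    where
    relation : ∀ {x y} → y ≡ l ℚ.* x → l ℚ.* x ℚ.+ ℚ.- 1ℚ ℚ.* y ≡ 0ℚ
    relation {x} refl = solve 2 (λ l x → l :* x :+ (:- con 1ℚ) :* (l :* x) := con 0ℚ) refl l x

  ¬Equiv⇒LinIndep : ∀ {j i} → ¬ ((A j ≡ 0ℤ) × (B j ≡ 0ℤ)) → ¬ ((A i ≡ 0ℤ) × (B i ≡ 0ℤ)) →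
                    ¬ Equiv A B j i → LinIndep A B j i
  ¬Equiv⇒LinIndep {j} {i} Λⱼ≢0 Λᵢ≢0 j≁i c d eqA eqB with c ℚ.≟ 0ℚ
  ... | no c≢0 = contradiction (l , l≢0 , xA , xB) j≁i
    where
    instance _ = ≢-nonZero c≢0
    l = ℚ.- (1/ c) ℚ.* d
    xA = p*x+q*y≡0⇒x≡-q/p*y c d _ _ eqA
    xB = p*x+q*y≡0⇒x≡-q/p*y c d _ _ eqB
    l≢0 : l ≢ 0ℚ
    l≢0 l≡0 = Λⱼ≢0 (vanishes A xA , vanishes B xB)
      where
      vanishes : ∀ (C : Fin s → ℤ) → toℚ (C j) ≡ l ℚ.* toℚ (C i) → C j ≡ 0ℤ
      vanishes C eq = toℚ≡0⇒≡0 (C j) (trans eq (trans (cong (ℚ._* toℚ (C i)) l≡0) (ℚₚ.*-zeroˡ (toℚ (C i)))))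
  ... | yes refl with d ℚ.≟ 0ℚ
  ...   | yes d≡0 = refl , d≡0
  ...   | no d≢0 = contradiction (vanishes A eqA , vanishes B eqB) Λᵢ≢0
    where
    instance _ = ≢-nonZero d≢0
    vanishes : ∀ (C : Fin s → ℤ) → 0ℚ ℚ.* toℚ (C j) ℚ.+ d ℚ.* toℚ (C i) ≡ 0ℚ → C i ≡ 0ℤ
    vanishes C eq = toℚ≡0⇒≡0 (C i) (p*q≡0⇒q≡0 d _
      (trans (solve 2 (λ x y → y := con 0ℚ :* x :+ y) refl (toℚ (C j)) (d ℚ.* toℚ (C i))) eq))

private variable
  n : ℕ
  x : Fin n

∣p∣≡∣p∩q∣+∣p─q∣ : ∀ (p q : Subset n) → ∣ p ∣ ≡ ∣ p ∩ q ∣ + ∣ p ─ q ∣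
∣p∣≡∣p∩q∣+∣p─q∣ []          []          = refl
∣p∣≡∣p∩q∣+∣p─q∣ (false ∷ p) (true ∷ q)  = ∣p∣≡∣p∩q∣+∣p─q∣ p q
∣p∣≡∣p∩q∣+∣p─q∣ (false ∷ p) (false ∷ q) = ∣p∣≡∣p∩q∣+∣p─q∣ p q
∣p∣≡∣p∩q∣+∣p─q∣ (true ∷ p)  (true ∷ q)  = cong suc (∣p∣≡∣p∩q∣+∣p─q∣ p q)
∣p∣≡∣p∩q∣+∣p─q∣ (true ∷ p)  (false ∷ q) =
  trans (cong suc (∣p∣≡∣p∩q∣+∣p─q∣ p q)) (sym (ℕₚ.+-suc _ _))

∣p∣≤∣p─q∣+∣q∣ : ∀ (p q : Subset n) → ∣ p ∣ ≤ ∣ p ─ q ∣ + ∣ q ∣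
∣p∣≤∣p─q∣+∣q∣ p q = begin
  ∣ p ∣                  ≡⟨ ∣p∣≡∣p∩q∣+∣p─q∣ p q ⟩
  ∣ p ∩ q ∣ + ∣ p ─ q ∣  ≤⟨ ℕₚ.+-monoˡ-≤ _ (∣p∩q∣≤∣q∣ p q) ⟩
  ∣ q ∣ + ∣ p ─ q ∣      ≡⟨ ℕₚ.+-comm ∣ q ∣ _ ⟩
  ∣ p ─ q ∣ + ∣ q ∣      ∎
  where open ℕₚ.≤-Reasoning

∣p∪q∣≤∣p∣+∣q∣ : ∀ (p q : Subset n) → ∣ p ∪ q ∣ ≤ ∣ p ∣ + ∣ q ∣
∣p∪q∣≤∣p∣+∣q∣ []          []          = z≤n
∣p∪q∣≤∣p∣+∣q∣ (true ∷ p)  (true ∷ q)  = s≤s (ℕₚ.≤-trans (∣p∪q∣≤∣p∣+∣q∣ p q) (ℕₚ.+-monoʳ-≤ ∣ p ∣ (ℕₚ.n≤1+n ∣ q ∣)))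
∣p∪q∣≤∣p∣+∣q∣ (true ∷ p)  (false ∷ q) = s≤s (∣p∪q∣≤∣p∣+∣q∣ p q)
∣p∪q∣≤∣p∣+∣q∣ (false ∷ p) (true ∷ q)  = ℕₚ.≤-trans (s≤s (∣p∪q∣≤∣p∣+∣q∣ p q)) (ℕₚ.≤-reflexive (sym (ℕₚ.+-suc _ _)))
∣p∪q∣≤∣p∣+∣q∣ (false ∷ p) (false ∷ q) = ∣p∪q∣≤∣p∣+∣q∣ p q

Empty⇒∣p∪q∣≡∣p∣+∣q∣ : ∀ (p q : Subset n) → Empty (p ∩ q) → ∣ p ∪ q ∣ ≡ ∣ p ∣ + ∣ q ∣
Empty⇒∣p∪q∣≡∣p∣+∣q∣ []          []          _     = refl
Empty⇒∣p∪q∣≡∣p∣+∣q∣ (true ∷ p)  (true ∷ q)  empty = contradiction (zero , here) empty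
Empty⇒∣p∪q∣≡∣p∣+∣q∣ (true ∷ p)  (false ∷ q) empty = cong suc (Empty⇒∣p∪q∣≡∣p∣+∣q∣ p q (drop-∷-Empty empty))
Empty⇒∣p∪q∣≡∣p∣+∣q∣ (false ∷ p) (true ∷ q)  empty =
  trans (cong suc (Empty⇒∣p∪q∣≡∣p∣+∣q∣ p q (drop-∷-Empty empty))) (sym (ℕₚ.+-suc _ _))
Empty⇒∣p∪q∣≡∣p∣+∣q∣ (false ∷ p) (false ∷ q) empty = Empty⇒∣p∪q∣≡∣p∣+∣q∣ p q (drop-∷-Empty empty)

x∈p⇒∣p∣≡1+∣p-x∣ : ∀ {p : Subset n} {x} → x ∈ p → ∣ p ∣ ≡ suc ∣ p - x ∣
x∈p⇒∣p∣≡1+∣p-x∣ {p = p} {x = x} x∈p = begin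
  ∣ p ∣                        ≡⟨ ∣p∣≡∣p∩q∣+∣p─q∣ p ⁅ x ⁆ ⟩
  ∣ p ∩ ⁅ x ⁆ ∣ + ∣ p - x ∣    ≡⟨ cong (_+ ∣ p - x ∣) (trans (cong ∣_∣ p∩⁅x⁆≡⁅x⁆) (∣⁅x⁆∣≡1 x)) ⟩
  suc ∣ p - x ∣                ∎
  where
  open ≡-Reasoning
  p∩⁅x⁆≡⁅x⁆ : p ∩ ⁅ x ⁆ ≡ ⁅ x ⁆
  p∩⁅x⁆≡⁅x⁆ = ⊆-antisym (p∩q⊆q p ⁅ x ⁆)
    (λ y∈⁅x⁆ → x∈p∩q⁺ (subst (_∈ p) (sym (x∈⁅y⁆⇒x≡y _ y∈⁅x⁆)) x∈p , y∈⁅x⁆))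

x∈p─q⇒x∉q : ∀ (p q : Subset n) → x ∈ p ─ q → x ∉ q
x∈p─q⇒x∉q (true ∷ p)  (false ∷ q) here       ()
x∈p─q⇒x∉q (b ∷ p)     (true ∷ q)  (there x∈) (there x∈q) = x∈p─q⇒x∉q p q x∈ x∈q
x∈p─q⇒x∉q (b ∷ p)     (false ∷ q) (there x∈) (there x∈q) = x∈p─q⇒x∉q p q x∈ x∈q

take : ℕ → Subset n → Subset n
take _       []          = []
take m       (false ∷ p) = false ∷ take m p
take zero    (true ∷ p)  = false ∷ take zero p
take (suc m) (true ∷ p)  = true ∷ take m p

∣take∣≡m⊓∣p∣ : ∀ m (p : Subset n) → ∣ take m p ∣ ≡ m ⊓ ∣ p ∣
∣take∣≡m⊓∣p∣ zero    []          = refl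
∣take∣≡m⊓∣p∣ (suc m) []          = refl
∣take∣≡m⊓∣p∣ m       (false ∷ p) = ∣take∣≡m⊓∣p∣ m p
∣take∣≡m⊓∣p∣ zero    (true ∷ p)  = ∣take∣≡m⊓∣p∣ zero p
∣take∣≡m⊓∣p∣ (suc m) (true ∷ p)  = cong suc (∣take∣≡m⊓∣p∣ m p)

take⊆ : ∀ m (p : Subset n) → take m p ⊆ p
take⊆ m       (false ∷ p) (there x∈) = there (take⊆ m p x∈)
take⊆ zero    (true ∷ p)  (there x∈) = there (take⊆ zero p x∈)
take⊆ (suc m) (true ∷ p)  here       = here
take⊆ (suc m) (true ∷ p)  (there x∈) = there (take⊆ m p x∈)

∣take∣≤m : ∀ m (p : Subset n) → ∣ take m p ∣ ≤ m
∣take∣≤m m p = ℕₚ.≤-trans (ℕₚ.≤-reflexive (∣take∣≡m⊓∣p∣ m p)) (ℕₚ.m⊓n≤m m ∣ p ∣)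

∣take∣≡m : ∀ {m} (p : Subset n) → m ≤ ∣ p ∣ → ∣ take m p ∣ ≡ m
∣take∣≡m {m = m} p m≤∣p∣ = trans (∣take∣≡m⊓∣p∣ m p) (ℕₚ.m≤n⇒m⊓n≡m m≤∣p∣)

∃⊆-∋-ofSize : ∀ {p : Subset n} {x m} → x ∈ p → suc m ≤ ∣ p ∣ → ∃ λ q → q ⊆ p × x ∈ q × ∣ q ∣ ≡ suc m
∃⊆-∋-ofSize {p = p} {x = x} {m = m} x∈p 1+m≤∣p∣ =
  ⁅ x ⁆ ∪ rest , q⊆p , x∈p∪q⁺ (inj₁ (x∈⁅x⁆ x)) ,
  trans (Empty⇒∣p∪q∣≡∣p∣+∣q∣ ⁅ x ⁆ rest x∉rest)
        (cong₂ _+_ (∣⁅x⁆∣≡1 x) (∣take∣≡m (p - x) (ℕₚ.≤-pred (subst (suc m ≤_) (x∈p⇒∣p∣≡1+∣p-x∣ x∈p) 1+m≤∣p∣))))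
  where
  rest = take m (p - x)
  q⊆p : ⁅ x ⁆ ∪ rest ⊆ p
  q⊆p y∈ with x∈p∪q⁻ ⁅ x ⁆ rest y∈
  ... | inj₁ y∈⁅x⁆ = subst (_∈ p) (sym (x∈⁅y⁆⇒x≡y _ y∈⁅x⁆)) x∈p
  ... | inj₂ y∈rest = p─q⊆p p ⁅ x ⁆ (take⊆ m (p - x) y∈rest)
  x∉rest : Empty (⁅ x ⁆ ∩ rest)
  x∉rest (y , y∈) with x∈p∩q⁻ ⁅ x ⁆ rest y∈
  ... | y∈⁅x⁆ , y∈rest = x∈p─q⇒x∉q p ⁅ x ⁆ (take⊆ m (p - x) y∈rest) y∈⁅x⁆

x∈⋃⁻ : ∀ {m} (K : Fin m → Subset n) → x ∈ ⋃ (tabulate K) → ∃ λ μ → x ∈ K μ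
x∈⋃⁻ {m = zero}  K x∈⊥ = contradiction x∈⊥ ∉⊥
x∈⋃⁻ {m = suc m} K x∈  with x∈p∪q⁻ (K zero) _ x∈
... | inj₁ x∈K₀   = zero , x∈K₀
... | inj₂ x∈rest = let μ , x∈Kμ = x∈⋃⁻ (K ∘ suc) x∈rest in suc μ , x∈Kμ

x∈⋃⁺ : ∀ {m} (K : Fin m → Subset n) μ → x ∈ K μ → x ∈ ⋃ (tabulate K)
x∈⋃⁺ K zero    x∈ = x∈p∪q⁺ (inj₁ x∈)
x∈⋃⁺ K (suc μ) x∈ = x∈p∪q⁺ (inj₂ (x∈⋃⁺ (K ∘ suc) μ x∈))

∣⋃∣≤m*c : ∀ {m c} (K : Fin m → Subset n) → (∀ μ → ∣ K μ ∣ ≤ c) → ∣ ⋃ (tabulate K) ∣ ≤ m * c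
∣⋃∣≤m*c {n} {zero}  K _     = ℕₚ.≤-reflexive (∣⊥∣≡0 n)
∣⋃∣≤m*c {n} {suc m} K ∣K∣≤c = ℕₚ.≤-trans (∣p∪q∣≤∣p∣+∣q∣ (K zero) _)
  (ℕₚ.+-mono-≤ (∣K∣≤c zero) (∣⋃∣≤m*c (K ∘ suc) (∣K∣≤c ∘ suc)))

m*c≤∣⋃∣ : ∀ {m c} (K : Fin m → Subset n) → (∀ {μ μ′} → μ ≢ μ′ → Empty (K μ ∩ K μ′)) →
          (∀ μ → c ≤ ∣ K μ ∣) → m * c ≤ ∣ ⋃ (tabulate K) ∣
m*c≤∣⋃∣ {m = zero}  K _        _     = z≤n
m*c≤∣⋃∣ {m = suc m} {c} K disjoint c≤∣K∣ = begin
  suc m * c                               ≤⟨ ℕₚ.+-mono-≤ (c≤∣K∣ zero) (m*c≤∣⋃∣ (K ∘ suc) (disjoint ∘ (_∘ Finₚ.suc-injective)) (c≤∣K∣ ∘ suc)) ⟩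
  ∣ K zero ∣ + ∣ ⋃ (tabulate (K ∘ suc)) ∣ ≡⟨ Empty⇒∣p∪q∣≡∣p∣+∣q∣ (K zero) _ K₀∩rest-empty ⟨
  ∣ ⋃ (tabulate K) ∣                      ∎
  where
  open ℕₚ.≤-Reasoning
  K₀∩rest-empty : Empty (K zero ∩ ⋃ (tabulate (K ∘ suc)))
  K₀∩rest-empty (x , x∈) with x∈p∩q⁻ (K zero) _ x∈
  ... | x∈K₀ , x∈rest with x∈⋃⁻ (K ∘ suc) x∈rest
  ... | μ , x∈Kμ = disjoint (λ ()) (x , x∈p∩q⁺ (x∈K₀ , x∈Kμ))

n+c≤n⊓a+b : ∀ {n a b c} → c ≤ b → n + c ≤ a + b → n + c ≤ n ⊓ a + b
n+c≤n⊓a+b {n} {a} c≤b n+c≤a+b with ℕₚ.≤-total n a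
... | inj₁ n≤a rewrite ℕₚ.m≤n⇒m⊓n≡m n≤a = ℕₚ.+-monoʳ-≤ n c≤b
... | inj₂ a≤n rewrite ℕₚ.m≥n⇒m⊓n≡n a≤n = n+c≤a+b

module Classes {s : ℕ} (22≤s : 22 ≤ s) (A B : Fin s → ℤ)
  (i : Fin 4 → Fin s) (K : Fin 4 → Subset s)
  (K-class : (μ : Fin 4) → IsClassOf A B (K μ) (i μ))
  (i-inequiv : (μ μ′ : Fin 4) → μ ≢ μ′ → ¬ Equiv A B (i μ) (i μ′))
  (K-maximal : (μ : Fin 4) (j : Fin s) (S : Subset s)
             → ((μ′ : Fin 4) → μ′ < μ → ¬ Equiv A B j (i μ′))
             → IsClassOf A B S j → ∣ S ∣ ≤ ∣ K μ ∣)
  (∣K₀∣≤7 : ∣ K zero ∣ ≤ 7) (∣K₁∣≤5 : ∣ K (suc zero) ∣ ≤ 5)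
  where

  K₀ K₃ : Subset s
  K₀ = K zero
  K₃ = K (suc (suc (suc zero)))

  ∈K⇒Equiv : ∀ {x μ} → x ∈ K μ → Equiv A B x (i μ)
  ∈K⇒Equiv {x} {μ} = Equivalence.to (K-class μ x)

  Equiv⇒∈K : ∀ {x μ} → Equiv A B x (i μ) → x ∈ K μ
  Equiv⇒∈K {x} {μ} = Equivalence.from (K-class μ x)

  i∈K : ∀ μ → i μ ∈ K μ
  i∈K μ = Equiv⇒∈K (Equiv-refl A B (i μ))

  ∈K-unique : ∀ {x μ μ′} → x ∈ K μ → x ∈ K μ′ → μ ≡ μ′
  ∈K-unique {μ = μ} {μ′} x∈Kμ x∈Kμ′ with μ Fin.≟ μ′
  ... | yes μ≡μ′ = μ≡μ′
  ... | no μ≢μ′ = contradiction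
    (Equiv-trans A B (Equiv-sym A B (∈K⇒Equiv x∈Kμ)) (∈K⇒Equiv x∈Kμ′)) (i-inequiv μ μ′ μ≢μ′)

  class⊆K : ∀ {S j μ} → IsClassOf A B S j → j ∈ K μ → S ⊆ K μ
  class⊆K S-class j∈K x∈S =
    Equiv⇒∈K (Equiv-trans A B (Equivalence.to (S-class _) x∈S) (∈K⇒Equiv j∈K))

  class∩K⇒∈K : ∀ {S j x μ} → IsClassOf A B S j → x ∈ S → x ∈ K μ → j ∈ K μ
  class∩K⇒∈K S-class x∈S x∈K =
    Equiv⇒∈K (Equiv-trans A B (Equiv-sym A B (Equivalence.to (S-class _) x∈S)) (∈K⇒Equiv x∈K))

  ∣K∣-antitone : ∀ {μ μ′} → μ Fin.≤ μ′ → ∣ K μ′ ∣ ≤ ∣ K μ ∣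
  ∣K∣-antitone {μ} {μ′} μ≤μ′ = K-maximal μ (i μ′) (K μ′) earlier (K-class μ′)
    where
    earlier : ∀ μ″ → μ″ < μ → ¬ Equiv A B (i μ′) (i μ″)
    earlier μ″ μ″<μ = i-inequiv μ′ μ″ (≢-sym (Finₚ.<⇒≢ (ℕₚ.<-≤-trans μ″<μ μ≤μ′)))

  ∣class∣≤∣K₃∣ : ∀ {S j} → IsClassOf A B S j → (∀ μ → j ∉ K μ) → ∣ S ∣ ≤ ∣ K₃ ∣
  ∣class∣≤∣K₃∣ {S} {j} S-class j∉K = K-maximal _ j S (λ μ _ → j∉K μ ∘ Equiv⇒∈K) S-class

  I : Subset s
  I = ∁ (⋃ (tabulate (⁅_⁆ ∘ i)))

  ∈I⁺ : ∀ {x} → (∀ μ → x ≢ i μ) → x ∈ I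
  ∈I⁺ x≢i = x∉p⇒x∈∁p λ x∈ → let μ , x∈⁅iμ⁆ = x∈⋃⁻ (⁅_⁆ ∘ i) x∈ in x≢i μ (x∈⁅y⁆⇒x≡y _ x∈⁅iμ⁆)

  ∈I⁻ : ∀ {x} → x ∈ I → ∀ μ → x ≢ i μ
  ∈I⁻ x∈I μ refl = x∈∁p⇒x∉p x∈I (x∈⋃⁺ (⁅_⁆ ∘ i) μ (x∈⁅x⁆ (i μ)))

  18≤∣I∣ : 18 ≤ ∣ I ∣
  18≤∣I∣ = begin
    22 ∸ 4                           ≤⟨ ℕₚ.∸-mono 22≤s (∣⋃∣≤m*c (⁅_⁆ ∘ i) (ℕₚ.≤-reflexive ∘ ∣⁅x⁆∣≡1 ∘ i)) ⟩
    s ∸ ∣ ⋃ (tabulate (⁅_⁆ ∘ i)) ∣   ≡⟨ ∣∁p∣≡n∸∣p∣ (⋃ (tabulate (⁅_⁆ ∘ i))) ⟨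
    ∣ I ∣                            ∎
    where open ℕₚ.≤-Reasoning

  I∩K≡K-i : ∀ μ → I ∩ K μ ≡ K μ - i μ
  I∩K≡K-i μ = ⊆-antisym
    (λ x∈I∩K → let x∈I , x∈K = x∈p∩q⁻ I (K μ) x∈I∩K in x∈p∧x≢y⇒x∈p-y x∈K (∈I⁻ x∈I μ))
    (λ x∈K-i → x∈p∩q⁺ (∈I⁺ (≢i x∈K-i) , p─q⊆p (K μ) ⁅ i μ ⁆ x∈K-i))
    where
    ≢i : ∀ {x} → x ∈ K μ - i μ → ∀ μ′ → x ≢ i μ′
    ≢i x∈K-i μ′ refl with ∈K-unique (p─q⊆p (K μ) ⁅ i μ ⁆ x∈K-i) (i∈K μ′)
    ... | refl = x∈p─q⇒x∉q (K μ) ⁅ i μ ⁆ x∈K-i (x∈⁅x⁆ (i μ))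

  ∣K∣≡1+∣I∩K∣ : ∀ μ → ∣ K μ ∣ ≡ suc ∣ I ∩ K μ ∣
  ∣K∣≡1+∣I∩K∣ μ = trans (x∈p⇒∣p∣≡1+∣p-x∣ (i∈K μ)) (cong (suc ∘ ∣_∣) (sym (I∩K≡K-i μ)))

  ∣I∩K[1+μ]∣≤4 : ∀ μ → ∣ I ∩ K (suc μ) ∣ ≤ 4
  ∣I∩K[1+μ]∣≤4 μ = ℕₚ.≤-pred (begin
    suc ∣ I ∩ K (suc μ) ∣  ≡⟨ ∣K∣≡1+∣I∩K∣ (suc μ) ⟨
    ∣ K (suc μ) ∣          ≤⟨ ∣K∣-antitone (s≤s z≤n) ⟩
    ∣ K (suc zero) ∣       ≤⟨ ∣K₁∣≤5 ⟩
    5                      ∎)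
    where open ℕₚ.≤-Reasoning

  choose-I₀ : ∀ ν k → ((j : Fin s) → ¬ ((A j ≡ 0ℤ) × (B j ≡ 0ℤ))) → k ∈ I → LinIndep A B (i ν) k →
              ∃ λ I₀ → I₀ ⊆ I × ∣ I₀ ∣ ≡ 8 × k ∈ I₀ × (∀ j → j ∈ I₀ → LinIndep A B j (i ν))
  choose-I₀ ν k Λ≢0 k∈I indep =
    let I₀ , I₀⊆Y , k∈I₀ , ∣I₀∣≡8 = ∃⊆-∋-ofSize k∈Y 8≤∣Y∣ in
    I₀ , p─q⊆p I (K ν) ∘ I₀⊆Y , ∣I₀∣≡8 , k∈I₀ ,
    λ j j∈I₀ → ¬Equiv⇒LinIndep A B (Λ≢0 j) (Λ≢0 (i ν))
                 (x∈p─q⇒x∉q I (K ν) (I₀⊆Y j∈I₀) ∘ Equiv⇒∈K)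
    where
    Y : Subset s
    Y = I ─ K ν

    k∈Y : k ∈ Y
    k∈Y = x∈p∧x∉q⇒x∈p─q k∈I (LinIndep⇒¬Equiv A B indep ∘ ∈K⇒Equiv)

    8≤∣Y∣ : 8 ≤ ∣ Y ∣
    8≤∣Y∣ = ℕₚ.≤-trans (ℕₚ.m≤m+n 8 3) (ℕₚ.+-cancelʳ-≤ 7 11 ∣ Y ∣ (begin
      18               ≤⟨ 18≤∣I∣ ⟩
      ∣ I ∣            ≤⟨ ∣p∣≤∣p─q∣+∣q∣ I (K ν) ⟩
      ∣ Y ∣ + ∣ K ν ∣  ≤⟨ ℕₚ.+-monoʳ-≤ ∣ Y ∣ (ℕₚ.≤-trans (∣K∣-antitone z≤n) ∣K₀∣≤7) ⟩
      ∣ Y ∣ + 7        ∎))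
      where open ℕₚ.≤-Reasoning

  record Pool (Z : Subset s) : Set where
    field
      Z⊆I     : Z ⊆ I
      16≤∣Z∣   : 16 ≤ ∣ Z ∣
      12≤∣Z─K₀∣ : 12 ≤ ∣ Z ─ K₀ ∣
      sparse  : ∀ {S j} → IsClassOf A B S j → j ∉ K₀ → ∣ S ∩ Z ∣ ≤ 4

  -- K₁, K₂ and K₃ lose their representative in I, so only classes of unrepresented
  -- indices need an argument.
  sparse-off-K₀ : ∀ {Z S j} → Z ⊆ I → ((∀ μ → j ∉ K μ) → ∣ S ∩ Z ∣ ≤ 4) →
                  IsClassOf A B S j → j ∉ K₀ → ∣ S ∩ Z ∣ ≤ 4
  sparse-off-K₀ {Z} {S} {j} Z⊆I unrepresented S-class j∉K₀ with Finₚ.any? (λ μ → j ∈? K μ)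
  ... | no ∄μ = unrepresented (λ μ j∈K → ∄μ (μ , j∈K))
  ... | yes (zero  , j∈K₀) = contradiction j∈K₀ j∉K₀
  ... | yes (suc μ , j∈K)  = ℕₚ.≤-trans (p⊆q⇒∣p∣≤∣q∣ S∩Z⊆I∩K) (∣I∩K[1+μ]∣≤4 μ)
    where
    S∩Z⊆I∩K : S ∩ Z ⊆ I ∩ K (suc μ)
    S∩Z⊆I∩K x∈ = let x∈S , x∈Z = x∈p∩q⁻ S Z x∈ in x∈p∩q⁺ (Z⊆I x∈Z , class⊆K S-class j∈K x∈S)

  small-pool : ∣ K₃ ∣ ≤ 4 → Pool I
  small-pool ∣K₃∣≤4 = record
    { Z⊆I      = id
    ; 16≤∣Z∣    = ℕₚ.≤-trans (ℕₚ.m≤m+n 16 2) 18≤∣I∣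
    ; 12≤∣Z─K₀∣ = ℕₚ.+-cancelˡ-≤ 6 12 ∣ I ─ K₀ ∣ (begin
        18                       ≤⟨ 18≤∣I∣ ⟩
        ∣ I ∣                    ≡⟨ ∣p∣≡∣p∩q∣+∣p─q∣ I K₀ ⟩
        ∣ I ∩ K₀ ∣ + ∣ I ─ K₀ ∣  ≤⟨ ℕₚ.+-monoˡ-≤ ∣ I ─ K₀ ∣ ∣I∩K₀∣≤6 ⟩
        6 + ∣ I ─ K₀ ∣           ∎)
    ; sparse   = λ {S} S-class → sparse-off-K₀ id (λ j∉K →
        ℕₚ.≤-trans (∣p∩q∣≤∣p∣ S I) (ℕₚ.≤-trans (∣class∣≤∣K₃∣ S-class j∉K) ∣K₃∣≤4)) S-class
    }
    where
    open ℕₚ.≤-Reasoning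
    ∣I∩K₀∣≤6 : ∣ I ∩ K₀ ∣ ≤ 6
    ∣I∩K₀∣≤6 = ℕₚ.≤-pred (ℕₚ.≤-trans (ℕₚ.≤-reflexive (sym (∣K∣≡1+∣I∩K∣ zero))) ∣K₀∣≤7)

  big-pool : 5 ≤ ∣ K₃ ∣ → Pool (⋃ (tabulate (λ μ → I ∩ K μ)))
  big-pool 5≤∣K₃∣ = record
    { Z⊆I      = Z⊆I
    ; 16≤∣Z∣    = m*c≤∣⋃∣ L L-disjoint 4≤∣L∣
    ; 12≤∣Z─K₀∣ = ℕₚ.≤-trans (m*c≤∣⋃∣ (L ∘ suc) (L-disjoint ∘ (_∘ Finₚ.suc-injective)) (4≤∣L∣ ∘ suc))
                            (p⊆q⇒∣p∣≤∣q∣ L[1+]⊆Z─K₀)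
    ; sparse   = λ {S} S-class → sparse-off-K₀ Z⊆I (λ j∉K → misses S-class j∉K) S-class
    }
    where
    L : Fin 4 → Subset s
    L μ = I ∩ K μ

    Z : Subset s
    Z = ⋃ (tabulate L)

    Z⊆I : Z ⊆ I
    Z⊆I x∈Z = let μ , x∈L = x∈⋃⁻ L x∈Z in p∩q⊆p I (K μ) x∈L

    L-disjoint : ∀ {μ μ′} → μ ≢ μ′ → Empty (L μ ∩ L μ′)
    L-disjoint {μ} {μ′} μ≢μ′ (x , x∈) = let x∈Lμ , x∈Lμ′ = x∈p∩q⁻ (L μ) (L μ′) x∈ in
      μ≢μ′ (∈K-unique (p∩q⊆q I (K μ) x∈Lμ) (p∩q⊆q I (K μ′) x∈Lμ′))

    4≤∣L∣ : ∀ μ → 4 ≤ ∣ L μ ∣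
    4≤∣L∣ μ = ℕₚ.≤-pred (begin
      5            ≤⟨ 5≤∣K₃∣ ⟩
      ∣ K₃ ∣       ≤⟨ ∣K∣-antitone (Finₚ.≤fromℕ μ) ⟩
      ∣ K μ ∣      ≡⟨ ∣K∣≡1+∣I∩K∣ μ ⟩
      suc ∣ L μ ∣  ∎)
      where open ℕₚ.≤-Reasoning

    L[1+]⊆Z─K₀ : ⋃ (tabulate (L ∘ suc)) ⊆ Z ─ K₀
    L[1+]⊆Z─K₀ x∈ = x∈p∧x∉q⇒x∈p─q (q⊆p∪q (L zero) _ x∈) λ x∈K₀ →
      let μ , x∈L = x∈⋃⁻ (L ∘ suc) x∈ in
      case ∈K-unique x∈K₀ (p∩q⊆q I (K (suc μ)) x∈L) of λ ()

    misses : ∀ {S j} → IsClassOf A B S j → (∀ μ → j ∉ K μ) → ∣ S ∩ Z ∣ ≤ 4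
    misses {S} S-class j∉K = ℕₚ.≤-trans (ℕₚ.≤-reflexive (trans (cong ∣_∣ (Empty-unique S∩Z-empty)) (∣⊥∣≡0 s))) z≤n
      where
      S∩Z-empty : Empty (S ∩ Z)
      S∩Z-empty (x , x∈) = let x∈S , x∈Z = x∈p∩q⁻ S Z x∈ ; μ , x∈L = x∈⋃⁻ L x∈Z in
        j∉K μ (class∩K⇒∈K S-class x∈S (p∩q⊆q I (K μ) x∈L))

  choose-I₁ : ∀ {Z I₀} → Pool Z → ∣ I₀ ∣ ≤ 8 →
              ∃ λ I₁ → I₁ ⊆ I ─ I₀ × ∣ I₁ ∣ ≡ 8 × (∀ j S → IsClassOf A B S j → ∣ S ∩ I₁ ∣ ≤ 4)
  choose-I₁ {Z} {I₀} pool ∣I₀∣≤8 = take 8 T , I₁⊆I─I₀ , ∣take∣≡m T 8≤∣T∣ , sparse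
    where
    open Pool pool renaming (sparse to Z-sparse)

    P T : Subset s
    P = Z ─ I₀
    T = take 4 (P ∩ K₀) ∪ (P ─ K₀)

    T⊆P : T ⊆ P
    T⊆P x∈T with x∈p∪q⁻ (take 4 (P ∩ K₀)) (P ─ K₀) x∈T
    ... | inj₁ x∈take = p∩q⊆p P K₀ (take⊆ 4 (P ∩ K₀) x∈take)
    ... | inj₂ x∈P─K₀ = p─q⊆p P K₀ x∈P─K₀

    I₁⊆I─I₀ : take 8 T ⊆ I ─ I₀
    I₁⊆I─I₀ x∈ = let x∈P = T⊆P (take⊆ 8 T x∈) in
      x∈p∧x∉q⇒x∈p─q (Z⊆I (p─q⊆p Z I₀ x∈P)) (x∈p─q⇒x∉q Z I₀ x∈P)

    ∣p∣≤∣p─I₀∣+8 : ∀ p → ∣ p ∣ ≤ ∣ p ─ I₀ ∣ + 8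
    ∣p∣≤∣p─I₀∣+8 p = ℕₚ.≤-trans (∣p∣≤∣p─q∣+∣q∣ p I₀) (ℕₚ.+-monoʳ-≤ ∣ p ─ I₀ ∣ ∣I₀∣≤8)

    4≤∣P─K₀∣ : 4 ≤ ∣ P ─ K₀ ∣
    4≤∣P─K₀∣ = ℕₚ.+-cancelʳ-≤ 8 4 ∣ P ─ K₀ ∣ (begin
      12                   ≤⟨ 12≤∣Z─K₀∣ ⟩
      ∣ Z ─ K₀ ∣           ≤⟨ ∣p∣≤∣p─I₀∣+8 (Z ─ K₀) ⟩
      ∣ Z ─ K₀ ─ I₀ ∣ + 8  ≡⟨ cong (λ q → ∣ q ∣ + 8) (p─q─r≡p─r─q Z K₀ I₀) ⟩
      ∣ P ─ K₀ ∣ + 8       ∎)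
      where open ℕₚ.≤-Reasoning

    8≤∣P∣ : 8 ≤ ∣ P ∣
    8≤∣P∣ = ℕₚ.+-cancelʳ-≤ 8 8 ∣ P ∣ (ℕₚ.≤-trans 16≤∣Z∣ (∣p∣≤∣p─I₀∣+8 Z))

    8≤∣T∣ : 8 ≤ ∣ T ∣
    8≤∣T∣ = begin
      8                                 ≤⟨ n+c≤n⊓a+b 4≤∣P─K₀∣ (ℕₚ.≤-trans 8≤∣P∣ (ℕₚ.≤-reflexive (∣p∣≡∣p∩q∣+∣p─q∣ P K₀))) ⟩
      4 ⊓ ∣ P ∩ K₀ ∣ + ∣ P ─ K₀ ∣       ≡⟨ cong (_+ ∣ P ─ K₀ ∣) (∣take∣≡m⊓∣p∣ 4 (P ∩ K₀)) ⟨
      ∣ take 4 (P ∩ K₀) ∣ + ∣ P ─ K₀ ∣  ≡⟨ Empty⇒∣p∪q∣≡∣p∣+∣q∣ _ (P ─ K₀) take∩P─K₀-empty ⟨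
      ∣ T ∣                             ∎
      where
      open ℕₚ.≤-Reasoning
      take∩P─K₀-empty : Empty (take 4 (P ∩ K₀) ∩ (P ─ K₀))
      take∩P─K₀-empty (x , x∈) = let x∈take , x∈P─K₀ = x∈p∩q⁻ (take 4 (P ∩ K₀)) (P ─ K₀) x∈ in
        x∈p─q⇒x∉q P K₀ x∈P─K₀ (p∩q⊆q P K₀ (take⊆ 4 (P ∩ K₀) x∈take))

    sparse : ∀ j S → IsClassOf A B S j → ∣ S ∩ take 8 T ∣ ≤ 4
    sparse j S S-class with j ∈? K₀
    ... | no j∉K₀ = ℕₚ.≤-trans (p⊆q⇒∣p∣≤∣q∣ S∩I₁⊆S∩Z) (Z-sparse S-class j∉K₀)
      where
      S∩I₁⊆S∩Z : S ∩ take 8 T ⊆ S ∩ Z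
      S∩I₁⊆S∩Z x∈ = let x∈S , x∈I₁ = x∈p∩q⁻ S _ x∈ in
        x∈p∩q⁺ (x∈S , p─q⊆p Z I₀ (T⊆P (take⊆ 8 T x∈I₁)))
    ... | yes j∈K₀ = ℕₚ.≤-trans (p⊆q⇒∣p∣≤∣q∣ S∩I₁⊆take) (∣take∣≤m 4 (P ∩ K₀))
      where
      S∩I₁⊆take : S ∩ take 8 T ⊆ take 4 (P ∩ K₀)
      S∩I₁⊆take x∈ with x∈p∩q⁻ S _ x∈
      ... | x∈S , x∈I₁ with x∈p∪q⁻ (take 4 (P ∩ K₀)) (P ─ K₀) (take⊆ 8 T x∈I₁)
      ...   | inj₁ x∈take = x∈take
      ...   | inj₂ x∈P─K₀ = contradiction (class⊆K S-class j∈K₀ x∈S) (x∈p─q⇒x∉q P K₀ x∈P─K₀)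

  pool : ∃ Pool
  pool with ∣ K₃ ∣ ≤? 4
  ... | yes ∣K₃∣≤4 = I , small-pool ∣K₃∣≤4
  ... | no ∣K₃∣≰4  = _ , big-pool (ℕₚ.≰⇒> ∣K₃∣≰4)

lemma6p1 : (s : ℕ) → 22 ≤ s → (A B : Fin s → ℤ)
    → ((j : Fin s) → ¬ ((A j ≡ 0ℤ) × (B j ≡ 0ℤ)))
    → q0≥ A B 12
    → (i : Fin 4 → Fin s) → (Cl : Fin 4 → Subset s)
    → ((μ : Fin 4) → IsClassOf A B (Cl μ) (i μ))
    → ((μ μ′ : Fin 4) → μ ≢ μ′ → ¬ Equiv A B (i μ) (i μ′))
    → ((μ : Fin 4) (j : Fin s) (S : Subset s)
         → ((μ′ : Fin 4) → μ′ < μ → ¬ Equiv A B j (i μ′))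
         → IsClassOf A B S j → ∣ S ∣ ≤ ∣ Cl μ ∣)
    → ∣ Cl zero ∣ ≤ 7
    → ∣ Cl (suc zero) ∣ ≤ 5
    → (ν : Fin 4) → (k : Fin s) → ((μ : Fin 4) → k ≢ i μ)
    → LinIndep A B (i ν) k
    → Σ (Subset s) λ I₀ → Σ (Subset s) λ I₁ →
        ((j : Fin s) → j ∈ I₀ → (μ : Fin 4) → j ≢ i μ)
      × ((j : Fin s) → j ∈ I₁ → (μ : Fin 4) → j ≢ i μ)
      × ((j : Fin s) → j ∈ I₀ → j ∉ I₁)
      × (∣ I₀ ∣ ≡ 8) × (∣ I₁ ∣ ≡ 8)
      × (k ∈ I₀)
      × ((j : Fin s) → j ∈ I₀ → LinIndep A B j (i ν))
      × ((j : Fin s) (S : Subset s) → IsClassOf A B S j → ∣ S ∩ I₁ ∣ ≤ 4)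
lemma6p1 s 22≤s A B Λ≢0 _ i K K-class i-inequiv K-maximal ∣K₀∣≤7 ∣K₁∣≤5 ν k k≢i indep =
  let I₀ , I₀⊆I , ∣I₀∣≡8 , k∈I₀ , I₀-indep = choose-I₀ ν k Λ≢0 (∈I⁺ k≢i) indep
      I₁ , I₁⊆I─I₀ , ∣I₁∣≡8 , I₁-sparse = choose-I₁ (proj₂ pool) (ℕₚ.≤-reflexive ∣I₀∣≡8)
  in  I₀ , I₁ ,
      (λ _ → ∈I⁻ ∘ I₀⊆I) ,
      (λ _ → ∈I⁻ ∘ p─q⊆p I I₀ ∘ I₁⊆I─I₀) ,
      (λ _ j∈I₀ j∈I₁ → x∈p─q⇒x∉q I I₀ (I₁⊆I─I₀ j∈I₁) j∈I₀) ,
      ∣I₀∣≡8 , ∣I₁∣≡8 , k∈I₀ , I₀-indep , I₁-sparse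
  where open Classes 22≤s A B i K K-class i-inequiv K-maximal ∣K₀∣≤7 ∣K₁∣≤5
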